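{- Let $G=K_{s_1, \ldots, s_k}$ be a complete multipartite graph with $k\geq 2$ parts, and suppose there is an integer $\ell \geq 2$ with $\ell \mid s_i$ for each $i$. Then $\delta^-(G)=1$.
   Context: For a graph $G=(V,E)$ with $m \geq 1$ edges and degrees $d_v$, for $A\subseteq V$ let ${\rm vol}(A)=\sum_{v\in A} d_v$ and let $e(A)$ be the number of edges with both ends in $A$. For a partition $\mathcal{A}$ of $V$, $q_{\mathcal A}(G)=\frac{1}{m}\sum_{A\in\mathcal A} e(A)-\frac{1}{4m^2}\sum_{A\in\mathcal A}{\rm vol}(A)^2$, and $q^*(G)=\max_{\mathcal A} q_{\mathcal A}(G)$; a graph with no edges has $q^*=0$. For a graph $H$, $\delta^-(H)$ is the least number of edges one can delete from $H$ to obtain a subgraph $H'$ with $q^*(H')>0$ ($\delta^-(H)=\infty$ if there is none). -}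

module Defs where

open import Data.Bool using (Bool; true; false; if_then_else_)
open import Data.Nat using (ℕ; zero; suc; _+_; _*_; _<_; _<ᵇ_)
open import Data.Fin using (Fin; toℕ; _≟_)
open import Data.List using (map; allFin)
open import Data.Nat.ListAction using (sum)
open import Data.Integer using (+_)
open import Data.Rational using (ℚ; 0ℚ; _/_; _-_) renaming (_<_ to _<ℚ_)
open import Data.Product using (Σ; ∃; _×_)
open import Relation.Nullary using (¬_; does)
open import Relation.Binary.PropositionalEquality using (_≡_)

ΣFin : {n : ℕ} → (Fin n → ℕ) → ℕ
ΣFin {n} f = sum (map f (allFin n))

⟦_⟧ : Bool → ℕ
⟦ true ⟧  = 1
⟦ false ⟧ = 0

_∧_ : Bool → Bool → Bool
true ∧ b = b
false ∧ _ = false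

record Graph (n : ℕ) : Set where
  field
    adj    : Fin n → Fin n → Bool
    symm   : ∀ u v → adj u v ≡ adj v u
    irrefl : ∀ v → adj v v ≡ false
open Graph public

-- number of edges m(G): unordered adjacent pairs {u,v}, counted once via toℕ u < toℕ v
edges : {n : ℕ} → Graph n → ℕ
edges G = ΣFin λ u → ΣFin λ v → ⟦ (toℕ u <ᵇ toℕ v) ∧ adj G u v ⟧

deg : {n : ℕ} → Graph n → Fin n → ℕ
deg G u = ΣFin λ v → ⟦ adj G u v ⟧

-- A partition of V = Fin n is given by a labelling c : Fin n → Fin n;
-- the parts are the nonempty fibres c⁻¹(a) (empty fibres contribute 0 below).
Labelling : ℕ → Set
Labelling n = Fin n → Fin n

inPart : {n : ℕ} → Labelling n → Fin n → Fin n → Bool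
inPart c a v = does (c v ≟ a)

eIn : {n : ℕ} → Graph n → Labelling n → Fin n → ℕ
eIn G c a = ΣFin λ u → ΣFin λ v →
  ⟦ (toℕ u <ᵇ toℕ v) ∧ (adj G u v ∧ (inPart c a u ∧ inPart c a v)) ⟧

vol : {n : ℕ} → Graph n → Labelling n → Fin n → ℕ
vol G c a = ΣFin λ v → ⟦ inPart c a v ⟧ * deg G v

-- modularity q_A(G) of the partition given by c; 0 when G has no edges
q : {n : ℕ} → Graph n → Labelling n → ℚ
q G c with edges G
... | zero  = 0ℚ
... | suc m' = ((+ ΣFin (eIn G c)) / suc m')
             - ((+ ΣFin (λ a → vol G c a * vol G c a)) / (4 * (suc m' * suc m')))

-- q*(G) > 0  (q* is the maximum of q over all partitions, so this says some partition has q > 0;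
-- for an edgeless graph q = 0 for every partition, matching q* = 0)
QStarPos : {n : ℕ} → Graph n → Set
QStarPos G = ∃ λ c → 0ℚ <ℚ q G c

_⊆G_ : {n : ℕ} → Graph n → Graph n → Set
H' ⊆G H = ∀ u v → adj H' u v ≡ true → adj H u v ≡ true

δ⁻≡ : {n : ℕ} → Graph n → ℕ → Set
δ⁻≡ H k =
  (Σ (Graph _) λ H' → H' ⊆G H × (edges H ≡ edges H' + k) × QStarPos H')
  × (∀ (H' : Graph _) (j : ℕ) → H' ⊆G H → edges H ≡ edges H' + j → j < k → ¬ QStarPos H')

partSize : {n k : ℕ} → (Fin n → Fin k) → Fin k → ℕ
partSize p i = ΣFin λ v → ⟦ does (p v ≟ i) ⟧

IsCompleteMultipartite : {n k : ℕ} → Graph n → (Fin n → Fin k) → Set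
IsCompleteMultipartite G p =
  (∀ i → ∃ λ v → p v ≡ i)
  × (∀ u v → (adj G u v ≡ true → ¬ p u ≡ p v) × (¬ p u ≡ p v → adj G u v ≡ true))

{-# OPTIONS --safe #-}
-- Write B(f, g) = Σ_{u,v} f u · A(u,v) · g v for the adjacency matrix A. For a vertex set P
-- with complement Q put X = B(1_P, 1_P) = 2e(P), Z = B(1_Q, 1_Q) and C = B(1_P, 1_Q); then
-- 2m = X + 2C + Z and vol(P) = X + C, so P contributes e(P)/m − vol(P)²/4m² ≤ 0 to the
-- modularity exactly when XZ ≤ C², and the partition {P, Q} has positive modularity when C² < XZ.
-- In a complete multipartite graph B(f, g) = Σf · Σg − Σᵢ fᵢ gᵢ, where fᵢ is the mass of f on the
-- i-th part, and termwise AM-GM yields XZ ≤ C²: no partition has positive modularity.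
-- If ℓ divides every part size sᵢ, let P take sᵢ/ℓ vertices of the i-th part. The masses of Q
-- are then (ℓ − 1) times those of P, which forces XZ = C². Deleting one edge between P and Q
-- lowers C by one and keeps X and Z, so afterwards C² < XZ.
module Submission where

open import Defs
open import Data.Bool using (Bool; true; false; not; _∨_; if_then_else_)
open import Data.Bool.Properties using (∨-comm; not-injective)
open import Data.Empty using (⊥-elim)
open import Data.Fin using (Fin; zero; suc; toℕ; _≟_)
open import Data.Fin.Properties using (toℕ-injective)
open import Data.List using (tabulate)
open import Data.List.Properties using (map-tabulate)
import Data.Nat.ListAction as List
open import Data.Nat using (ℕ; zero; suc; _+_; _*_; _∸_; _≤_; _<_; z≤n; s≤s; _<ᵇ_; _⊓_)
open import Data.Nat.Divisibility using (_∣_)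
open import Data.Nat.Properties hiding (_≟_)
open import Algebra.Properties.Semiring.Sum +-*-semiring
  using (sum; ∑-distrib-+; ∑-comm; *-distribˡ-sum; *-distribʳ-sum; sum-cong-≗; sum-replicate-zero)
open import Data.Nat.Tactic.RingSolver using (solve-∀)
open import Data.Product using (Σ; ∃; _×_; _,_; proj₁; proj₂)
open import Data.Sum using (_⊎_; inj₁; inj₂; map₁)
open import Function using (_∘_; _⇔_; mk⇔; Equivalence)
import Function.Properties.Equivalence as ⇔
import Data.Integer as ℤ
import Data.Integer.Properties as ℤₚ
import Data.Rational as ℚ
open ℚ using (ℚ; 0ℚ)
import Data.Rational.Properties as ℚₚ
import Data.Rational.Unnormalised as ℚᵘ
import Data.Rational.Unnormalised.Properties as ℚᵘₚ
open import Relation.Nullary using (¬_; does; yes; no)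
open import Relation.Nullary.Decidable using (dec-true; dec-false)
open import Relation.Binary.PropositionalEquality

sum-cong : ∀ {n} {f g : Fin n → ℕ} → (∀ i → f i ≡ g i) → sum f ≡ sum g
sum-cong {f = f} {g} = sum-cong-≗ {x = f} {y = g}

sum-tabulate : ∀ {n} (f : Fin n → ℕ) → List.sum (tabulate f) ≡ sum f
sum-tabulate {zero}  f = refl
sum-tabulate {suc n} f = cong (f zero +_) (sum-tabulate (f ∘ suc))

ΣFin≡sum : ∀ {n} (f : Fin n → ℕ) → ΣFin f ≡ sum f
ΣFin≡sum f = trans (cong List.sum (map-tabulate (λ i → i) f)) (sum-tabulate f)

ΣFin²≡sum² : ∀ {n} (f : Fin n → Fin n → ℕ) → ΣFin (λ u → ΣFin (f u)) ≡ sum (λ u → sum (f u))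
ΣFin²≡sum² f = trans (ΣFin≡sum (λ u → ΣFin (f u))) (sum-cong (ΣFin≡sum ∘ f))

sum-mono-≤ : ∀ {n} {f g : Fin n → ℕ} → (∀ i → f i ≤ g i) → sum f ≤ sum g
sum-mono-≤ {zero}  f≤g = z≤n
sum-mono-≤ {suc n} f≤g = +-mono-≤ (f≤g zero) (sum-mono-≤ (f≤g ∘ suc))

sum-≡⇒≗ : ∀ {n} {f g : Fin n → ℕ} → (∀ i → f i ≤ g i) → sum f ≡ sum g → ∀ i → f i ≡ g i
sum-≡⇒≗ {suc n} {f} {g} f≤g eq = λ where
    zero    → head≡
    (suc i) → sum-≡⇒≗ (f≤g ∘ suc) (+-cancelˡ-≡ (f zero) _ _ (trans eq (cong (_+ _) (sym head≡)))) i
  where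
  head≡ : f zero ≡ g zero
  head≡ = ≤-antisym (f≤g zero) (+-cancelʳ-≤ (sum (f ∘ suc)) _ _ (begin
    g zero + sum (f ∘ suc) ≤⟨ +-monoʳ-≤ (g zero) (sum-mono-≤ (f≤g ∘ suc)) ⟩
    g zero + sum (g ∘ suc) ≡⟨ sym eq ⟩
    f zero + sum (f ∘ suc) ∎))
    where open ≤-Reasoning

≤-sum : ∀ {n} (f : Fin n → ℕ) i → f i ≤ sum f
≤-sum f zero    = m≤m+n _ _
≤-sum f (suc i) = ≤-trans (≤-sum (f ∘ suc) i) (m≤n+m _ (f zero))

sum>0⇒∃>0 : ∀ {n} (f : Fin n → ℕ) → 0 < sum f → ∃ λ i → 0 < f i
sum>0⇒∃>0 {suc n} f 0<Σ with f zero in eq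
... | suc _ = zero , subst (0 <_) (sym eq) (s≤s z≤n)
... | zero  with sum>0⇒∃>0 (f ∘ suc) 0<Σ
...   | i , 0<fi = suc i , 0<fi

sum-*-sum : ∀ {n} (f g : Fin n → ℕ) → sum (λ u → sum (λ v → f u * g v)) ≡ sum f * sum g
sum-*-sum {n} f g = begin
  sum (λ u → sum (λ v → f u * g v)) ≡⟨ sum-cong (λ u → sym (*-distribˡ-sum (f u) g)) ⟩
  sum (λ u → f u * sum g)           ≡⟨ sym (*-distribʳ-sum (sum g) f) ⟩
  sum f * sum g                     ∎
  where open ≡-Reasoning

δ : ∀ {n} → Fin n → Fin n → ℕ
δ i j = ⟦ does (i ≟ j) ⟧

δ-≡ : ∀ {n} {i j : Fin n} → i ≡ j → δ i j ≡ 1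
δ-≡ {i = i} {j} i≡j = cong ⟦_⟧ (dec-true (i ≟ j) i≡j)

δ-≢ : ∀ {n} {i j : Fin n} → ¬ i ≡ j → δ i j ≡ 0
δ-≢ {i = i} {j} i≢j = cong ⟦_⟧ (dec-false (i ≟ j) i≢j)

δ-sym : ∀ {n} (i j : Fin n) → δ i j ≡ δ j i
δ-sym i j with i ≟ j
... | yes i≡j = sym (δ-≡ (sym i≡j))
... | no  i≢j = sym (δ-≢ (i≢j ∘ sym))

δ≤1 : ∀ {n} (i j : Fin n) → δ i j ≤ 1
δ≤1 i j with i ≟ j
... | yes _ = s≤s z≤n
... | no  _ = z≤n

sum-δ : ∀ {n} (i : Fin n) (f : Fin n → ℕ) → sum (λ j → δ i j * f j) ≡ f i
sum-δ {suc n} zero f = begin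
  f zero + 0 + sum {n} (λ _ → 0) ≡⟨ cong (f zero + 0 +_) (sum-replicate-zero n) ⟩
  f zero + 0 + 0                 ≡⟨ cong (_+ 0) (+-identityʳ (f zero)) ⟩
  f zero + 0                     ≡⟨ +-identityʳ (f zero) ⟩
  f zero                         ∎
  where open ≡-Reasoning
sum-δ {suc n} (suc i) f = sum-δ i (f ∘ suc)

sum-on-pair : ∀ {n} (h : Fin n → ℕ) {a b : Fin n} → ¬ a ≡ b →
              (∀ x → ¬ x ≡ a → ¬ x ≡ b → h x ≡ 0) → sum h ≡ h a + h b
sum-on-pair h {a} {b} a≢b outside = begin
  sum h                                         ≡⟨ sum-cong split ⟩
  sum (λ x → δ a x * h a + δ b x * h b)         ≡⟨ ∑-distrib-+ (λ x → δ a x * h a) _ ⟩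
  sum (λ x → δ a x * h a) + sum (λ x → δ b x * h b)
    ≡⟨ cong₂ _+_ (sum-δ a (λ _ → h a)) (sum-δ b (λ _ → h b)) ⟩
  h a + h b                                     ∎
  where
  open ≡-Reasoning
  split : ∀ x → h x ≡ δ a x * h a + δ b x * h b
  split x with a ≟ x | b ≟ x
  ... | yes refl | yes refl = ⊥-elim (a≢b refl)
  ... | yes refl | no _     = sym (trans (+-identityʳ _) (+-identityʳ _))
  ... | no _     | yes refl = sym (+-identityʳ _)
  ... | no a≢x   | no b≢x   = outside x (a≢x ∘ sym) (b≢x ∘ sym)

before : ∀ {n} → (Fin n → ℕ) → Fin n → ℕ
before g v = sum (λ w → ⟦ toℕ w <ᵇ toℕ v ⟧ * g w)

sum-select-prefix : ∀ {n} (g : Fin n → ℕ) → (∀ v → g v ≤ 1) →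
            ∀ T → sum (λ v → g v * ⟦ before g v <ᵇ T ⟧) ≡ T ⊓ sum g
sum-select-prefix {zero}  g g≤1 T = sym (⊓-zeroʳ T)
sum-select-prefix {suc n} g g≤1 T with g zero | g≤1 zero
... | zero     | _ = sum-select-prefix (g ∘ suc) (g≤1 ∘ suc) T
... | suc zero | _ with T
...   | zero    = trans (sum-cong (λ v → *-zeroʳ (g (suc v)))) (sum-replicate-zero n)
...   | suc T-1 rewrite sum-replicate-zero n =
        cong suc (sum-select-prefix (g ∘ suc) (g≤1 ∘ suc) T-1)
sum-select-prefix {suc n} g g≤1 T | suc (suc _) | s≤s ()

⟦∧⟧ : ∀ a b → ⟦ a ∧ b ⟧ ≡ ⟦ a ⟧ * ⟦ b ⟧
⟦∧⟧ true  b = sym (+-identityʳ ⟦ b ⟧)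
⟦∧⟧ false b = refl

⟦⟧+⟦not⟧ : ∀ a → ⟦ a ⟧ + ⟦ not a ⟧ ≡ 1
⟦⟧+⟦not⟧ true  = refl
⟦⟧+⟦not⟧ false = refl

⟦⟧≡⟦∧true⟧+0 : ∀ x → ⟦ x ⟧ ≡ ⟦ x ∧ true ⟧ + 0
⟦⟧≡⟦∧true⟧+0 true  = refl
⟦⟧≡⟦∧true⟧+0 false = refl

∧-comm : ∀ a b → a ∧ b ≡ b ∧ a
∧-comm true  true  = refl
∧-comm true  false = refl
∧-comm false true  = refl
∧-comm false false = refl

<ᵇ-total : ∀ m n → m ≡ n ⊎ ⟦ m <ᵇ n ⟧ + ⟦ n <ᵇ m ⟧ ≡ 1
<ᵇ-total zero    zero    = inj₁ refl
<ᵇ-total zero    (suc n) = inj₂ refl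
<ᵇ-total (suc m) zero    = inj₂ refl
<ᵇ-total (suc m) (suc n) = map₁ (cong suc) (<ᵇ-total m n)

upper : ∀ {n} → Fin n → Fin n → ℕ
upper u v = ⟦ toℕ u <ᵇ toℕ v ⟧

sum²-symmetric : ∀ {n} (F : Fin n → Fin n → ℕ) → (∀ u v → F u v ≡ F v u) → (∀ u → F u u ≡ 0) →
                 sum (λ u → sum (λ v → F u v)) ≡ 2 * sum (λ u → sum (λ v → upper u v * F u v))
sum²-symmetric {n} F F-sym F-diag = begin
  sum (λ u → sum (λ v → F u v))
    ≡⟨ sum-cong (λ u → trans (sum-cong (split u)) (∑-distrib-+ (λ v → upper u v * F u v) _)) ⟩
  sum (λ u → sum (λ v → upper u v * F u v) + sum (λ v → upper v u * F u v))
    ≡⟨ ∑-distrib-+ (λ u → sum (λ v → upper u v * F u v)) _ ⟩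
  T + sum (λ u → sum (λ v → upper v u * F u v))
    ≡⟨ cong (T +_) (∑-comm (λ u v → upper v u * F u v)) ⟩
  T + sum (λ v → sum (λ u → upper v u * F u v))
    ≡⟨ cong (T +_) (sum-cong (λ v → sum-cong (λ u → cong (upper v u *_) (F-sym u v)))) ⟩
  T + T
    ≡⟨ cong (T +_) (sym (+-identityʳ T)) ⟩
  2 * T ∎
  where
  open ≡-Reasoning
  T = sum (λ u → sum (λ v → upper u v * F u v))
  split : ∀ u v → F u v ≡ upper u v * F u v + upper v u * F u v
  split u v with <ᵇ-total (toℕ u) (toℕ v)
  ... | inj₁ eq rewrite toℕ-injective eq | F-diag v =
        sym (cong₂ _+_ (*-zeroʳ (upper v v)) (*-zeroʳ (upper v v)))
  ... | inj₂ eq = sym (trans (sym (*-distribʳ-+ (F u v) (upper u v) (upper v u)))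
                             (trans (cong (_* F u v) eq) (*-identityˡ (F u v))))

sum²-upper-pairs : ∀ {n} (R : Fin n → Fin n → Bool) → (∀ u v → R u v ≡ R v u) → (∀ u → R u u ≡ false) →
                   2 * ΣFin (λ u → ΣFin (λ v → ⟦ (toℕ u <ᵇ toℕ v) ∧ R u v ⟧))
                   ≡ sum (λ u → sum (λ v → ⟦ R u v ⟧))
sum²-upper-pairs R R-sym R-irrefl = begin
  2 * ΣFin (λ u → ΣFin (λ v → ⟦ (toℕ u <ᵇ toℕ v) ∧ R u v ⟧))
    ≡⟨ cong (2 *_) (ΣFin²≡sum² (λ u v → ⟦ (toℕ u <ᵇ toℕ v) ∧ R u v ⟧)) ⟩
  2 * sum (λ u → sum (λ v → ⟦ (toℕ u <ᵇ toℕ v) ∧ R u v ⟧))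
    ≡⟨ cong (2 *_) (sum-cong λ u → sum-cong λ v → ⟦∧⟧ (toℕ u <ᵇ toℕ v) (R u v)) ⟩
  2 * sum (λ u → sum (λ v → upper u v * ⟦ R u v ⟧))
    ≡⟨ sym (sum²-symmetric (λ u v → ⟦ R u v ⟧) (λ u v → cong ⟦_⟧ (R-sym u v)) (λ u → cong ⟦_⟧ (R-irrefl u))) ⟩
  sum (λ u → sum (λ v → ⟦ R u v ⟧)) ∎
  where open ≡-Reasoning

2xy≤x²+y²-≤ : ∀ {x y} → x ≤ y → 2 * x * y ≤ x * x + y * y
2xy≤x²+y²-≤ {x} {y} x≤y = subst (λ z → 2 * x * z ≤ x * x + z * z) (m+[n∸m]≡n x≤y)
  (subst (2 * x * (x + d) ≤_) (expand x d) (m≤m+n _ (d * d)))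
  where
  d = y ∸ x
  expand : ∀ x d → 2 * x * (x + d) + d * d ≡ x * x + (x + d) * (x + d)
  expand = solve-∀

2xy≤x²+y² : ∀ x y → 2 * x * y ≤ x * x + y * y
2xy≤x²+y² x y with ≤-total x y
... | inj₁ x≤y = 2xy≤x²+y²-≤ x≤y
... | inj₂ y≤x = subst₂ _≤_ (swap y x) (+-comm (y * y) (x * x)) (2xy≤x²+y²-≤ y≤x)
  where
  swap : ∀ y x → 2 * y * x ≡ 2 * x * y
  swap = solve-∀

4xy≤[x+y]² : ∀ x y → 4 * x * y ≤ (x + y) * (x + y)
4xy≤[x+y]² x y = subst₂ _≤_ (double x y) (expand x y) (+-monoʳ-≤ (2 * x * y) (2xy≤x²+y² x y))
  where
  double : ∀ x y → 2 * x * y + 2 * x * y ≡ 4 * x * y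
  double = solve-∀
  expand : ∀ x y → 2 * x * y + (x * x + y * y) ≡ (x + y) * (x + y)
  expand = solve-∀

-- With A = Σ aᵢ, B = Σ bᵢ, X = A² − Σ aᵢ², Z = B² − Σ bᵢ², C = AB − Σ aᵢbᵢ, the last
-- hypothesis gives A²Z + B²X ≤ 2ABC, and AM-GM turns this into XZ ≤ C².
reverse-cauchy-schwarz : ∀ {X Z C A B SA SB SAB} →
  X + SA ≡ A * A → Z + SB ≡ B * B → C + SAB ≡ A * B →
  2 * (A * B) * SAB ≤ A * A * SB + B * B * SA → X * Z ≤ C * C
reverse-cauchy-schwarz {X} {A = zero} X+SA≡0 _ _ _ rewrite m+n≡0⇒m≡0 X X+SA≡0 = z≤n
reverse-cauchy-schwarz {X} {Z} {B = zero} _ Z+SB≡0 _ _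
  rewrite m+n≡0⇒m≡0 Z Z+SB≡0 | *-zeroʳ X = z≤n
reverse-cauchy-schwarz {X} {Z} {C} {A@(suc _)} {B@(suc _)} {SA} {SB} {SAB} hX hZ hC hS =
  *-cancelˡ-≤ (4 * (A * B) * (A * B)) (begin
    4 * (A * B) * (A * B) * (X * Z)        ≡⟨ regroup A B X Z ⟩
    4 * (A * A * Z) * (B * B * X)          ≤⟨ 4xy≤[x+y]² (A * A * Z) (B * B * X) ⟩
    (A * A * Z + B * B * X) * (A * A * Z + B * B * X)
                                           ≤⟨ *-mono-≤ weighted≤ weighted≤ ⟩
    2 * (A * B) * C * (2 * (A * B) * C)    ≡⟨ regroup′ A B C ⟩
    4 * (A * B) * (A * B) * (C * C)        ∎)
  where
  open ≤-Reasoning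
  regroup : ∀ A B X Z → 4 * (A * B) * (A * B) * (X * Z) ≡ 4 * (A * A * Z) * (B * B * X)
  regroup = solve-∀
  regroup′ : ∀ A B C → 2 * (A * B) * C * (2 * (A * B) * C) ≡ 4 * (A * B) * (A * B) * (C * C)
  regroup′ = solve-∀
  weighted≤ : A * A * Z + B * B * X ≤ 2 * (A * B) * C
  weighted≤ = +-cancelʳ-≤ (A * A * SB + B * B * SA) _ _ (begin
    A * A * Z + B * B * X + (A * A * SB + B * B * SA) ≡⟨ collect A B X Z SA SB ⟩
    A * A * (Z + SB) + B * B * (X + SA)               ≡⟨ cong₂ (λ z x → A * A * z + B * B * x) hZ hX ⟩
    A * A * (B * B) + B * B * (A * A)                 ≡⟨ symmetrise A B ⟩
    2 * (A * B) * (A * B)                             ≡⟨ cong (2 * (A * B) *_) (sym hC) ⟩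
    2 * (A * B) * (C + SAB)                           ≡⟨ *-distribˡ-+ (2 * (A * B)) C SAB ⟩
    2 * (A * B) * C + 2 * (A * B) * SAB               ≤⟨ +-monoʳ-≤ (2 * (A * B) * C) hS ⟩
    2 * (A * B) * C + (A * A * SB + B * B * SA)       ∎)
    where
    collect : ∀ A B X Z SA SB → A * A * Z + B * B * X + (A * A * SB + B * B * SA)
                                ≡ A * A * (Z + SB) + B * B * (X + SA)
    collect = solve-∀
    symmetrise : ∀ A B → A * A * (B * B) + B * B * (A * A) ≡ 2 * (A * B) * (A * B)
    symmetrise = solve-∀

reverse-cauchy-schwarz-≡ : ∀ {X Z C A SA} r → X + SA ≡ A * A →
  Z + r * r * SA ≡ (r * A) * (r * A) → C + r * SA ≡ A * (r * A) → X * Z ≡ C * C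
reverse-cauchy-schwarz-≡ {X} {Z} {C} {A} {SA} r hX hZ hC = begin
  X * Z               ≡⟨ cong (X *_) Z≡r²X ⟩
  X * (r * r * X)     ≡⟨ square r X ⟩
  (r * X) * (r * X)   ≡⟨ cong (λ y → y * y) (sym C≡rX) ⟩
  C * C               ∎
  where
  open ≡-Reasoning
  square : ∀ r X → X * (r * r * X) ≡ (r * X) * (r * X)
  square = solve-∀
  scale : ∀ s {Y} → Y + s * SA ≡ s * (A * A) → Y ≡ s * X
  scale s {Y} h = +-cancelʳ-≡ (s * SA) Y (s * X)
    (trans h (trans (cong (s *_) (sym hX)) (*-distribˡ-+ s X SA)))
  Z≡r²X : Z ≡ r * r * X
  Z≡r²X = scale (r * r) (trans hZ (expand r A))
    where
    expand : ∀ r A → (r * A) * (r * A) ≡ r * r * (A * A)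
    expand = solve-∀
  C≡rX : C ≡ r * X
  C≡rX = scale r (trans hC (expand r A))
    where
    expand : ∀ r A → A * (r * A) ≡ r * (A * A)
    expand = solve-∀

4me≤v² : ∀ {m e v X C Z} → 2 * m ≡ X + 2 * C + Z → 2 * e ≡ X → v ≡ X + C →
         X * Z ≤ C * C → 4 * m * e ≤ v * v
4me≤v² {m} {e} {v} {X} {C} {Z} hm he hv XZ≤C² = *-cancelˡ-≤ 4 (begin
  4 * (4 * m * e)                       ≡⟨ regroup m e ⟩
  4 * ((2 * m) * (2 * e))               ≡⟨ cong₂ (λ s t → 4 * (s * t)) hm he ⟩
  4 * ((X + 2 * C + Z) * X)             ≡⟨ expand X C Z ⟩
  4 * (X * X + 2 * C * X) + 4 * (X * Z) ≤⟨ +-monoʳ-≤ (4 * (X * X + 2 * C * X)) (*-monoʳ-≤ 4 XZ≤C²) ⟩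
  4 * (X * X + 2 * C * X) + 4 * (C * C) ≡⟨ complete X C ⟩
  4 * ((X + C) * (X + C))               ≡⟨ cong (λ y → 4 * (y * y)) (sym hv) ⟩
  4 * (v * v)                           ∎)
  where
  open ≤-Reasoning
  regroup : ∀ m e → 4 * (4 * m * e) ≡ 4 * ((2 * m) * (2 * e))
  regroup = solve-∀
  expand : ∀ X C Z → 4 * ((X + 2 * C + Z) * X) ≡ 4 * (X * X + 2 * C * X) + 4 * (X * Z)
  expand = solve-∀
  complete : ∀ X C → 4 * (X * X + 2 * C * X) + 4 * (C * C) ≡ 4 * ((X + C) * (X + C))
  complete = solve-∀

v₁²+v₂²<4m[e₁+e₂] : ∀ {m e₁ e₂ v₁ v₂ X C Z} → 2 * m ≡ X + 2 * C + Z → 2 * e₁ ≡ X → 2 * e₂ ≡ Z →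
                    v₁ ≡ X + C → v₂ ≡ Z + C → C * C < X * Z → v₁ * v₁ + v₂ * v₂ < 4 * m * (e₁ + e₂)
v₁²+v₂²<4m[e₁+e₂] {m} {e₁} {e₂} {v₁} {v₂} {X} {C} {Z} hm h₁ h₂ hv₁ hv₂ C²<XZ =
  *-cancelˡ-< 4 _ _ (begin-strict
    4 * (v₁ * v₁ + v₂ * v₂)                      ≡⟨ cong₂ (λ s t → 4 * (s * s + t * t)) hv₁ hv₂ ⟩
    4 * ((X + C) * (X + C) + (Z + C) * (Z + C))  ≡⟨ expand X C Z ⟩
    T + 8 * (C * C)                              <⟨ +-monoʳ-< T (*-monoʳ-< 8 C²<XZ) ⟩
    T + 8 * (X * Z)                              ≡⟨ factor X C Z ⟩
    4 * ((X + 2 * C + Z) * (X + Z))              ≡⟨ cong₂ (λ s t → 4 * (s * t)) (sym hm) (sym (cong₂ _+_ h₁ h₂)) ⟩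
    4 * ((2 * m) * (2 * e₁ + 2 * e₂))            ≡⟨ regroup m e₁ e₂ ⟩
    4 * (4 * m * (e₁ + e₂))                      ∎)
  where
  open ≤-Reasoning
  T = 4 * (X * X + Z * Z + 2 * C * X + 2 * C * Z)
  expand : ∀ X C Z → 4 * ((X + C) * (X + C) + (Z + C) * (Z + C))
                     ≡ 4 * (X * X + Z * Z + 2 * C * X + 2 * C * Z) + 8 * (C * C)
  expand = solve-∀
  factor : ∀ X C Z → 4 * (X * X + Z * Z + 2 * C * X + 2 * C * Z) + 8 * (X * Z)
                     ≡ 4 * ((X + 2 * C + Z) * (X + Z))
  factor = solve-∀
  regroup : ∀ m a b → 4 * ((2 * m) * (2 * a + 2 * b)) ≡ 4 * (4 * m * (a + b))
  regroup = solve-∀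

2AB∑ab≤A²∑b²+B²∑a² : ∀ {k} A B (a b : Fin k → ℕ) →
  2 * (A * B) * sum (λ i → a i * b i) ≤ A * A * sum (λ i → b i * b i) + B * B * sum (λ i → a i * a i)
2AB∑ab≤A²∑b²+B²∑a² {k} A B a b = begin
  2 * (A * B) * sum (λ i → a i * b i)
    ≡⟨ *-distribˡ-sum (2 * (A * B)) (λ i → a i * b i) ⟩
  sum (λ i → 2 * (A * B) * (a i * b i))
    ≡⟨ sum-cong (λ i → regroup A B (a i) (b i)) ⟩
  sum (λ i → 2 * (A * b i) * (B * a i))
    ≤⟨ sum-mono-≤ (λ i → 2xy≤x²+y² (A * b i) (B * a i)) ⟩
  sum (λ i → (A * b i) * (A * b i) + (B * a i) * (B * a i))
    ≡⟨ sum-cong (λ i → expand A B (a i) (b i)) ⟩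
  sum (λ i → A * A * (b i * b i) + B * B * (a i * a i))
    ≡⟨ ∑-distrib-+ (λ i → A * A * (b i * b i)) _ ⟩
  sum (λ i → A * A * (b i * b i)) + sum (λ i → B * B * (a i * a i))
    ≡⟨ sym (cong₂ _+_ (*-distribˡ-sum (A * A) (λ i → b i * b i)) (*-distribˡ-sum (B * B) (λ i → a i * a i))) ⟩
  A * A * sum (λ i → b i * b i) + B * B * sum (λ i → a i * a i) ∎
  where
  open ≤-Reasoning
  regroup : ∀ A B x y → 2 * (A * B) * (x * y) ≡ 2 * (A * y) * (B * x)
  regroup = solve-∀
  expand : ∀ A B x y → (A * y) * (A * y) + (B * x) * (B * x) ≡ A * A * (y * y) + B * B * (x * x)
  expand = solve-∀

𝟙 : ∀ {n} → Fin n → ℕ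
𝟙 _ = 1

χ : ∀ {n} → (Fin n → Bool) → Fin n → ℕ
χ P v = ⟦ P v ⟧

∁ : ∀ {n} → (Fin n → Bool) → Fin n → Bool
∁ P v = not (P v)

𝟙≡χ+χ∁ : ∀ {n} (P : Fin n → Bool) v → 𝟙 v ≡ χ P v + χ (∁ P) v
𝟙≡χ+χ∁ P v = sym (⟦⟧+⟦not⟧ (P v))

adjℕ : ∀ {n} → Graph n → Fin n → Fin n → ℕ
adjℕ H u v = ⟦ adj H u v ⟧

form : ∀ {n} → Graph n → (Fin n → ℕ) → (Fin n → ℕ) → ℕ
form H f g = sum (λ u → sum (λ v → f u * (adjℕ H u v * g v)))

module _ {n : ℕ} (H : Graph n) where

  form-cong : ∀ {f f′ g g′ : Fin n → ℕ} → (∀ u → f u ≡ f′ u) → (∀ v → g v ≡ g′ v) →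
              form H f g ≡ form H f′ g′
  form-cong f≗f′ g≗g′ = sum-cong λ u → sum-cong λ v →
    cong₂ (λ x y → x * (adjℕ H u v * y)) (f≗f′ u) (g≗g′ v)

  form-sym : ∀ f g → form H f g ≡ form H g f
  form-sym f g = trans (∑-comm (λ u v → f u * (adjℕ H u v * g v))) (sum-cong λ v → sum-cong λ u → swap (f u) (g v) (symm H u v))
    where
    swap : ∀ x y {a b} → a ≡ b → x * (⟦ a ⟧ * y) ≡ y * (⟦ b ⟧ * x)
    swap x y {a} refl = rearrange x ⟦ a ⟧ y
      where
      rearrange : ∀ x a y → x * (a * y) ≡ y * (a * x)
      rearrange = solve-∀

  form-+ˡ : ∀ {f} f₁ f₂ g → (∀ u → f u ≡ f₁ u + f₂ u) → form H f g ≡ form H f₁ g + form H f₂ g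
  form-+ˡ {f} f₁ f₂ g split = begin
    form H f g
      ≡⟨ sum-cong (λ u → sum-cong λ v →
           trans (cong (_* (adjℕ H u v * g v)) (split u)) (*-distribʳ-+ _ (f₁ u) (f₂ u))) ⟩
    sum (λ u → sum (λ v → f₁ u * (adjℕ H u v * g v) + f₂ u * (adjℕ H u v * g v)))
      ≡⟨ sum-cong (λ u → ∑-distrib-+ (λ v → f₁ u * (adjℕ H u v * g v)) _) ⟩
    sum (λ u → sum (λ v → f₁ u * (adjℕ H u v * g v)) + sum (λ v → f₂ u * (adjℕ H u v * g v)))
      ≡⟨ ∑-distrib-+ (λ u → sum (λ v → f₁ u * (adjℕ H u v * g v))) _ ⟩
    form H f₁ g + form H f₂ g ∎
    where open ≡-Reasoning

  form-+ʳ : ∀ f {g} g₁ g₂ → (∀ v → g v ≡ g₁ v + g₂ v) → form H f g ≡ form H f g₁ + form H f g₂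
  form-+ʳ f {g} g₁ g₂ split = begin
    form H f g                 ≡⟨ form-sym f g ⟩
    form H g f                 ≡⟨ form-+ˡ g₁ g₂ f split ⟩
    form H g₁ f + form H g₂ f  ≡⟨ cong₂ _+_ (form-sym g₁ f) (form-sym g₂ f) ⟩
    form H f g₁ + form H f g₂  ∎
    where open ≡-Reasoning

  form-zeroˡ : ∀ g → form H (λ _ → 0) g ≡ 0
  form-zeroˡ g = begin
    sum {n} (λ u → sum {n} (λ v → 0)) ≡⟨ sum-cong {n} (λ _ → sum-replicate-zero n) ⟩
    sum {n} (λ u → 0)                 ≡⟨ sum-replicate-zero n ⟩
    0                                 ∎
    where open ≡-Reasoning

  edges-form : 2 * edges H ≡ form H 𝟙 𝟙
  edges-form = begin
    2 * edges H                          ≡⟨ sum²-upper-pairs (adj H) (symm H) (irrefl H) ⟩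
    sum (λ u → sum (λ v → adjℕ H u v))   ≡⟨ sum-cong {n} (λ u → sum-cong {n} λ v →
                                              sym (trans (+-identityʳ _) (*-identityʳ _))) ⟩
    form H 𝟙 𝟙                           ∎
    where open ≡-Reasoning

  eIn-form : ∀ c a → 2 * eIn H c a ≡ form H (χ (inPart c a)) (χ (inPart c a))
  eIn-form c a = trans (sum²-upper-pairs R R-sym R-irrefl) (sum-cong λ u → sum-cong λ v →
      trans (⟦∧⟧ (adj H u v) (P u ∧ P v)) (trans (cong (adjℕ H u v *_) (⟦∧⟧ (P u) (P v)))
        (reorder (adjℕ H u v) (χ P u) (χ P v))))
    where
    P = inPart c a
    R : Fin n → Fin n → Bool
    R u v = adj H u v ∧ (P u ∧ P v)
    R-sym : ∀ u v → R u v ≡ R v u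
    R-sym u v = cong₂ _∧_ (symm H u v) (∧-comm (P u) (P v))
    R-irrefl : ∀ u → R u u ≡ false
    R-irrefl u = cong (_∧ (P u ∧ P u)) (irrefl H u)
    reorder : ∀ a x y → a * (x * y) ≡ x * (a * y)
    reorder = solve-∀

  vol-form : ∀ c a → vol H c a ≡ form H (χ (inPart c a)) 𝟙
  vol-form c a = trans (ΣFin≡sum (λ u → χ P u * deg H u)) (sum-cong λ u → begin
    χ P u * deg H u                         ≡⟨ cong (χ P u *_) (ΣFin≡sum (adjℕ H u)) ⟩
    χ P u * sum (adjℕ H u)                  ≡⟨ *-distribˡ-sum (χ P u) (adjℕ H u) ⟩
    sum (λ v → χ P u * adjℕ H u v)          ≡⟨ sum-cong {n} (λ v → cong (χ P u *_) (sym (*-identityʳ _))) ⟩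
    sum (λ v → χ P u * (adjℕ H u v * 1))    ∎)
    where
    open ≡-Reasoning
    P = inPart c a

inner : ∀ {n} → Graph n → (Fin n → Bool) → ℕ
inner H P = form H (χ P) (χ P)

cut : ∀ {n} → Graph n → (Fin n → Bool) → ℕ
cut H P = form H (χ P) (χ (∁ P))

module _ {n : ℕ} (H : Graph n) (P : Fin n → Bool) where

  vol-split : form H (χ P) 𝟙 ≡ inner H P + cut H P
  vol-split = form-+ʳ H (χ P) (χ P) (χ (∁ P)) (𝟙≡χ+χ∁ P)

  vol∁-split : form H (χ (∁ P)) 𝟙 ≡ inner H (∁ P) + cut H P
  vol∁-split = begin
    form H (χ (∁ P)) 𝟙                                ≡⟨ form-+ʳ H (χ (∁ P)) (χ P) (χ (∁ P)) (𝟙≡χ+χ∁ P) ⟩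
    form H (χ (∁ P)) (χ P) + inner H (∁ P)            ≡⟨ +-comm _ (inner H (∁ P)) ⟩
    inner H (∁ P) + form H (χ (∁ P)) (χ P)            ≡⟨ cong (inner H (∁ P) +_) (form-sym H (χ (∁ P)) (χ P)) ⟩
    inner H (∁ P) + cut H P                           ∎
    where open ≡-Reasoning

  edges-split : 2 * edges H ≡ inner H P + 2 * cut H P + inner H (∁ P)
  edges-split = begin
    2 * edges H                                       ≡⟨ edges-form H ⟩
    form H 𝟙 𝟙                                        ≡⟨ form-+ˡ H (χ P) (χ (∁ P)) 𝟙 (𝟙≡χ+χ∁ P) ⟩
    form H (χ P) 𝟙 + form H (χ (∁ P)) 𝟙               ≡⟨ cong₂ _+_ vol-split vol∁-split ⟩
    inner H P + cut H P + (inner H (∁ P) + cut H P)   ≡⟨ regroup (inner H P) (cut H P) (inner H (∁ P)) ⟩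
    inner H P + 2 * cut H P + inner H (∁ P)           ∎
    where
    open ≡-Reasoning
    regroup : ∀ x c z → x + c + (z + c) ≡ x + 2 * c + z
    regroup = solve-∀

/<⇔*< : ∀ a b c d → (ℤ.+ a ℚ./ suc b) ℚ.< (ℤ.+ c ℚ./ suc d) ⇔ a * suc d < c * suc b
/<⇔*< a b c d = mk⇔ to from
  where
  a/b≃ : ℚ.toℚᵘ (ℤ.+ a ℚ./ suc b) ℚᵘ.≃ ℚᵘ.mkℚᵘ (ℤ.+ a) b
  a/b≃ = ℚₚ.toℚᵘ-fromℚᵘ (ℚᵘ.mkℚᵘ (ℤ.+ a) b)
  c/d≃ : ℚ.toℚᵘ (ℤ.+ c ℚ./ suc d) ℚᵘ.≃ ℚᵘ.mkℚᵘ (ℤ.+ c) d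
  c/d≃ = ℚₚ.toℚᵘ-fromℚᵘ (ℚᵘ.mkℚᵘ (ℤ.+ c) d)
  to : (ℤ.+ a ℚ./ suc b) ℚ.< (ℤ.+ c ℚ./ suc d) → a * suc d < c * suc b
  to lt with ℚᵘₚ.<-respʳ-≃ c/d≃ (ℚᵘₚ.<-respˡ-≃ a/b≃ (ℚₚ.toℚᵘ-mono-< lt))
  ... | ℚᵘ.*<* lt′ = ℤₚ.drop‿+<+ (subst₂ ℤ._<_ (sym (ℤₚ.pos-* a (suc d))) (sym (ℤₚ.pos-* c (suc b))) lt′)
  from : a * suc d < c * suc b → (ℤ.+ a ℚ./ suc b) ℚ.< (ℤ.+ c ℚ./ suc d)
  from lt = ℚₚ.toℚᵘ-cancel-< (ℚᵘₚ.<-respʳ-≃ (ℚᵘₚ.≃-sym c/d≃) (ℚᵘₚ.<-respˡ-≃ (ℚᵘₚ.≃-sym a/b≃)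
    (ℚᵘ.*<* (subst₂ ℤ._<_ (ℤₚ.pos-* a (suc d)) (ℤₚ.pos-* c (suc b)) (ℤ.+<+ lt)))))

0<-⇔< : ∀ p r → 0ℚ ℚ.< p ℚ.- r ⇔ r ℚ.< p
0<-⇔< p r = mk⇔
  (λ lt → subst₂ ℚ._<_ (ℚₚ.+-identityˡ r) (p-r+r≡p) (ℚₚ.+-monoˡ-< r lt))
  (λ lt → subst (ℚ._< p ℚ.- r) (ℚₚ.+-inverseʳ r) (ℚₚ.+-monoˡ-< (ℚ.- r) lt))
  where
  p-r+r≡p : (p ℚ.- r) ℚ.+ r ≡ p
  p-r+r≡p = trans (ℚₚ.+-assoc p (ℚ.- r) r) (trans (cong (p ℚ.+_) (ℚₚ.+-inverseˡ r)) (ℚₚ.+-identityʳ p))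

0<q⇔ : ∀ {n} (H : Graph n) (c : Labelling n) →
       0ℚ ℚ.< q H c ⇔ ΣFin (λ a → vol H c a * vol H c a) < 4 * edges H * ΣFin (eIn H c)
0<q⇔ H c with edges H
... | zero  = mk⇔ (λ lt → ⊥-elim (ℚₚ.<-irrefl refl lt)) (λ ())
... | suc m = ⇔.trans (0<-⇔< _ _) (⇔.trans (/<⇔*< V _ E m) (mk⇔
    (λ lt → *-cancelʳ-< (suc m) V (4 * suc m * E) (subst (V * suc m <_) reassoc lt))
    (λ lt → subst (V * suc m <_) (sym reassoc) (*-monoˡ-< (suc m) lt))))
  where
  V = ΣFin (λ a → vol H c a * vol H c a)
  E = ΣFin (eIn H c)
  reassoc : E * (4 * (suc m * suc m)) ≡ 4 * suc m * E * suc m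
  reassoc = rearrange E (suc m)
    where
    rearrange : ∀ e k → e * (4 * (k * k)) ≡ 4 * k * e * k
    rearrange = solve-∀

mass : ∀ {n k} → (Fin n → Fin k) → (Fin n → ℕ) → Fin k → ℕ
mass p f i = sum (λ u → δ (p u) i * f u)

sum-mass : ∀ {n k} (p : Fin n → Fin k) f → sum (mass p f) ≡ sum f
sum-mass p f = trans (∑-comm (λ i u → δ (p u) i * f u)) (sum-cong λ u → sum-δ (p u) (λ _ → f u))

sum-mass² : ∀ {n k} (p : Fin n → Fin k) f g →
            sum (λ i → mass p f i * mass p g i) ≡ sum (λ u → sum (λ v → f u * (δ (p u) (p v) * g v)))
sum-mass² {n} {k} p f g = begin
  sum (λ i → mass p f i * mass p g i)
    ≡⟨ sum-cong (λ i → sym (sum-*-sum (λ u → δ (p u) i * f u) (λ v → δ (p v) i * g v))) ⟩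
  sum (λ i → sum (λ u → sum (λ v → term u v i)))
    ≡⟨ ∑-comm (λ i u → sum (λ v → term u v i)) ⟩
  sum (λ u → sum (λ i → sum (λ v → term u v i)))
    ≡⟨ sum-cong (λ u → ∑-comm (λ i v → term u v i)) ⟩
  sum (λ u → sum (λ v → sum (λ i → term u v i)))
    ≡⟨ sum-cong (λ u → sum-cong λ v → same-part u v) ⟩
  sum (λ u → sum (λ v → f u * (δ (p u) (p v) * g v))) ∎
  where
  open ≡-Reasoning
  term : Fin n → Fin n → Fin k → ℕ
  term u v i = δ (p u) i * f u * (δ (p v) i * g v)
  regroup : ∀ x y a b → x * a * (y * b) ≡ a * b * (x * y)
  regroup = solve-∀
  same-part : ∀ u v → sum (term u v) ≡ f u * (δ (p u) (p v) * g v)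
  same-part u v = begin
    sum (term u v)                                   ≡⟨ sum-cong (λ i → regroup (δ (p u) i) (δ (p v) i) (f u) (g v)) ⟩
    sum (λ i → f u * g v * (δ (p u) i * δ (p v) i))  ≡⟨ sym (*-distribˡ-sum (f u * g v) (λ i → δ (p u) i * δ (p v) i)) ⟩
    f u * g v * sum (λ i → δ (p u) i * δ (p v) i)    ≡⟨ cong (f u * g v *_) (trans (sum-δ (p u) (δ (p v))) (δ-sym (p v) (p u))) ⟩
    f u * g v * δ (p u) (p v)                        ≡⟨ regroup′ (f u) (g v) (δ (p u) (p v)) ⟩
    f u * (δ (p u) (p v) * g v)                      ∎
    where
    regroup′ : ∀ x y d → x * y * d ≡ x * (d * y)
    regroup′ = solve-∀

Multipartite : ∀ {n k} → Graph n → (Fin n → Fin k) → Set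
Multipartite H p = ∀ u v → (adj H u v ≡ true → ¬ p u ≡ p v) × (¬ p u ≡ p v → adj H u v ≡ true)

module _ {n k : ℕ} {H : Graph n} {p : Fin n → Fin k} (multipartite : Multipartite H p) where

  adj+δ≡1 : ∀ u v → adjℕ H u v + δ (p u) (p v) ≡ 1
  adj+δ≡1 u v with p u ≟ p v | adj H u v in eq
  ... | yes same | true  = ⊥-elim (proj₁ (multipartite u v) eq same)
  ... | yes _    | false = refl
  ... | no _     | true  = refl
  ... | no apart | false with () ← trans (sym eq) (proj₂ (multipartite u v) apart)

  form+sum-mass² : ∀ f g → form H f g + sum (λ i → mass p f i * mass p g i) ≡ sum f * sum g
  form+sum-mass² f g = begin
    form H f g + sum (λ i → mass p f i * mass p g i)
      ≡⟨ cong (form H f g +_) (sum-mass² p f g) ⟩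
    form H f g + sum (λ u → sum (λ v → f u * (δ (p u) (p v) * g v)))
      ≡⟨ sym (∑-distrib-+ (λ u → sum (λ v → f u * (adjℕ H u v * g v))) _) ⟩
    sum (λ u → sum (λ v → f u * (adjℕ H u v * g v)) + sum (λ v → f u * (δ (p u) (p v) * g v)))
      ≡⟨ sum-cong (λ u → sym (∑-distrib-+ (λ v → f u * (adjℕ H u v * g v)) _)) ⟩
    sum (λ u → sum (λ v → f u * (adjℕ H u v * g v) + f u * (δ (p u) (p v) * g v)))
      ≡⟨ sum-cong (λ u → sum-cong λ v → collect (f u) (g v) (adjℕ H u v) (δ (p u) (p v)) (adj+δ≡1 u v)) ⟩
    sum (λ u → sum (λ v → f u * g v))
      ≡⟨ sum-*-sum f g ⟩
    sum f * sum g ∎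
    where
    open ≡-Reasoning
    collect : ∀ x y a d → a + d ≡ 1 → x * (a * y) + x * (d * y) ≡ x * y
    collect x y a d a+d≡1 = begin
      x * (a * y) + x * (d * y) ≡⟨ factor x y a d ⟩
      x * ((a + d) * y)         ≡⟨ cong (λ s → x * (s * y)) a+d≡1 ⟩
      x * (1 * y)               ≡⟨ cong (x *_) (*-identityˡ y) ⟩
      x * y                     ∎
      where
      factor : ∀ x y a d → x * (a * y) + x * (d * y) ≡ x * ((a + d) * y)
      factor = solve-∀

  form²≤cross² : ∀ f g → form H f f * form H g g ≤ form H f g * form H f g
  form²≤cross² f g = reverse-cauchy-schwarz
    {X = form H f f} {form H g g} {form H f g} {sum f} {sum g}
    {sum (λ i → mass p f i * mass p f i)} {sum (λ i → mass p g i * mass p g i)} {sum (λ i → mass p f i * mass p g i)}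
    (form+sum-mass² f f) (form+sum-mass² g g) (form+sum-mass² f g)
    (2AB∑ab≤A²∑b²+B²∑a² (sum f) (sum g) (mass p f) (mass p g))

  form²≡cross² : ∀ f g r → (∀ i → mass p g i ≡ r * mass p f i) →
                 form H f f * form H g g ≡ form H f g * form H f g
  form²≡cross² f g r g≡rf = reverse-cauchy-schwarz-≡ r (form+sum-mass² f f)
    (subst₂ (λ s t → form H g g + s ≡ t * t) Σg²≡r²Σf² Σg≡rΣf (form+sum-mass² g g))
    (subst₂ (λ s t → form H f g + s ≡ sum f * t) Σfg≡rΣf² Σg≡rΣf (form+sum-mass² f g))
    where
    open ≡-Reasoning
    Σg≡rΣf : sum g ≡ r * sum f
    Σg≡rΣf = begin
      sum g                       ≡⟨ sym (sum-mass p g) ⟩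
      sum (mass p g)              ≡⟨ sum-cong g≡rf ⟩
      sum (λ i → r * mass p f i)  ≡⟨ sym (*-distribˡ-sum r (mass p f)) ⟩
      r * sum (mass p f)          ≡⟨ cong (r *_) (sum-mass p f) ⟩
      r * sum f                   ∎
    Σg²≡r²Σf² : sum (λ i → mass p g i * mass p g i) ≡ r * r * sum (λ i → mass p f i * mass p f i)
    Σg²≡r²Σf² = trans (sum-cong λ i → trans (cong (λ y → y * y) (g≡rf i)) (square r (mass p f i)))
                      (sym (*-distribˡ-sum (r * r) (λ i → mass p f i * mass p f i)))
      where
      square : ∀ r x → (r * x) * (r * x) ≡ r * r * (x * x)
      square = solve-∀
    Σfg≡rΣf² : sum (λ i → mass p f i * mass p g i) ≡ r * sum (λ i → mass p f i * mass p f i)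
    Σfg≡rΣf² = trans (sum-cong λ i → trans (cong (mass p f i *_) (g≡rf i)) (swap (mass p f i) r))
                     (sym (*-distribˡ-sum r (λ i → mass p f i * mass p f i)))
      where
      swap : ∀ x r → x * (r * x) ≡ r * (x * x)
      swap = solve-∀

  4me≤vol² : ∀ c a → 4 * edges H * eIn H c a ≤ vol H c a * vol H c a
  4me≤vol² c a = 4me≤v² {edges H} {eIn H c a} {vol H c a} {inner H P} {cut H P} {inner H (∁ P)}
    (edges-split H P) (eIn-form H c a) (trans (vol-form H c a) (vol-split H P))
    (form²≤cross² (χ P) (χ (∁ P)))
    where P = inPart c a

  q≯0 : ∀ c → ¬ (0ℚ ℚ.< q H c)
  q≯0 c 0<q = <⇒≱ (Equivalence.to (0<q⇔ H c) 0<q) (begin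
    4 * edges H * ΣFin (eIn H c)                    ≡⟨ cong (4 * edges H *_) (ΣFin≡sum (eIn H c)) ⟩
    4 * edges H * sum (eIn H c)                     ≡⟨ *-distribˡ-sum (4 * edges H) (eIn H c) ⟩
    sum (λ a → 4 * edges H * eIn H c a)             ≤⟨ sum-mono-≤ (4me≤vol² c) ⟩
    sum (λ a → vol H c a * vol H c a)               ≡⟨ sym (ΣFin≡sum (λ a → vol H c a * vol H c a)) ⟩
    ΣFin (λ a → vol H c a * vol H c a)              ∎)
    where open ≤-Reasoning

twoBlock : ∀ {n} → (Fin n → Bool) → Fin n → Fin n → Labelling n
twoBlock P a b v = if P v then a else b

module _ {n : ℕ} (H : Graph n) (P : Fin n → Bool) {a b : Fin n} (a≢b : ¬ a ≡ b) where

  private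
    c = twoBlock P a b

  inPart-twoBlock-a : ∀ v → inPart c a v ≡ P v
  inPart-twoBlock-a v with P v
  ... | true  = dec-true (a ≟ a) refl
  ... | false = dec-false (b ≟ a) (a≢b ∘ sym)

  inPart-twoBlock-b : ∀ v → inPart c b v ≡ ∁ P v
  inPart-twoBlock-b v with P v
  ... | true  = dec-false (a ≟ b) a≢b
  ... | false = dec-true (b ≟ b) refl

  inPart-twoBlock-other : ∀ x → ¬ x ≡ a → ¬ x ≡ b → ∀ v → inPart c x v ≡ false
  inPart-twoBlock-other x x≢a x≢b v with P v
  ... | true  = dec-false (a ≟ x) (x≢a ∘ sym)
  ... | false = dec-false (b ≟ x) (x≢b ∘ sym)

  private
    χ-other : ∀ x → ¬ x ≡ a → ¬ x ≡ b → ∀ v → χ (inPart c x) v ≡ 0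
    χ-other x x≢a x≢b v = cong ⟦_⟧ (inPart-twoBlock-other x x≢a x≢b v)

    eIn-other : ∀ x → ¬ x ≡ a → ¬ x ≡ b → eIn H c x ≡ 0
    eIn-other x x≢a x≢b = m+n≡0⇒m≡0 (eIn H c x) (begin
      eIn H c x + (eIn H c x + 0)                        ≡⟨ eIn-form H c x ⟩
      form H (χ (inPart c x)) (χ (inPart c x))           ≡⟨ form-cong H (χ-other x x≢a x≢b) (χ-other x x≢a x≢b) ⟩
      form H (λ _ → 0) (λ _ → 0)                         ≡⟨ form-zeroˡ H (λ _ → 0) ⟩
      0                                                  ∎)
      where open ≡-Reasoning

    vol-other : ∀ x → ¬ x ≡ a → ¬ x ≡ b → vol H c x * vol H c x ≡ 0
    vol-other x x≢a x≢b = cong (λ y → y * y) (begin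
      vol H c x                        ≡⟨ vol-form H c x ⟩
      form H (χ (inPart c x)) 𝟙        ≡⟨ form-cong H (χ-other x x≢a x≢b) (λ _ → refl) ⟩
      form H (λ _ → 0) 𝟙               ≡⟨ form-zeroˡ H 𝟙 ⟩
      0                                ∎)
      where open ≡-Reasoning

    χ-a : ∀ v → χ (inPart c a) v ≡ χ P v
    χ-a v = cong ⟦_⟧ (inPart-twoBlock-a v)

    χ-b : ∀ v → χ (inPart c b) v ≡ χ (∁ P) v
    χ-b v = cong ⟦_⟧ (inPart-twoBlock-b v)

  0<q-twoBlock : cut H P * cut H P < inner H P * inner H (∁ P) → 0ℚ ℚ.< q H c
  0<q-twoBlock sparse = Equivalence.from (0<q⇔ H c) (subst₂ (λ V E → V < 4 * edges H * E) (sym ΣV) (sym ΣE)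
    (v₁²+v₂²<4m[e₁+e₂] {edges H} {eIn H c a} {eIn H c b} {vol H c a} {vol H c b}
      {inner H P} {cut H P} {inner H (∁ P)}
      (edges-split H P)
      (trans (eIn-form H c a) (form-cong H χ-a χ-a))
      (trans (eIn-form H c b) (form-cong H χ-b χ-b))
      (trans (vol-form H c a) (trans (form-cong H χ-a (λ _ → refl)) (vol-split H P)))
      (trans (vol-form H c b) (trans (form-cong H χ-b (λ _ → refl)) (vol∁-split H P)))
      sparse))
    where
    ΣE : ΣFin (eIn H c) ≡ eIn H c a + eIn H c b
    ΣE = trans (ΣFin≡sum (eIn H c)) (sum-on-pair (eIn H c) a≢b eIn-other)
    ΣV : ΣFin (λ x → vol H c x * vol H c x) ≡ vol H c a * vol H c a + vol H c b * vol H c b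
    ΣV = trans (ΣFin≡sum (λ x → vol H c x * vol H c x)) (sum-on-pair (λ x → vol H c x * vol H c x) a≢b vol-other)

isEdge : ∀ {n} → Fin n → Fin n → Fin n → Fin n → Bool
isEdge a b u v = (does (a ≟ u) ∧ does (b ≟ v)) ∨ (does (b ≟ u) ∧ does (a ≟ v))

isEdge-sym : ∀ {n} (a b u v : Fin n) → isEdge a b u v ≡ isEdge a b v u
isEdge-sym a b u v = trans (∨-comm (does (a ≟ u) ∧ does (b ≟ v)) _)
  (cong₂ _∨_ (∧-comm (does (b ≟ u)) (does (a ≟ v))) (∧-comm (does (a ≟ u)) (does (b ≟ v))))

deleteEdge : ∀ {n} → Graph n → Fin n → Fin n → Graph n
deleteEdge G a b = record
  { adj    = λ u v → adj G u v ∧ not (isEdge a b u v)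
  ; symm   = λ u v → cong₂ (λ x e → x ∧ not e) (symm G u v) (isEdge-sym a b u v)
  ; irrefl = λ v → cong (_∧ not (isEdge a b v v)) (irrefl G v)
  }

deleteEdge-⊆ : ∀ {n} (G : Graph n) a b → deleteEdge G a b ⊆G G
deleteEdge-⊆ G a b u v = ∧-true (adj G u v)
  where
  ∧-true : ∀ x {y} → x ∧ y ≡ true → x ≡ true
  ∧-true true _ = refl

module _ {n : ℕ} (G : Graph n) {a b : Fin n} (a≢b : ¬ a ≡ b) (ab : adj G a b ≡ true) where

  private
    G′ = deleteEdge G a b

  adj-deleteEdge : ∀ u v → adjℕ G u v ≡ adjℕ G′ u v + (δ a u * δ b v + δ b u * δ a v)
  adj-deleteEdge u v with a ≟ u | b ≟ v | b ≟ u | a ≟ v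
  ... | yes refl | yes refl | yes b≡a  | _        = ⊥-elim (a≢b (sym b≡a))
  ... | yes refl | yes refl | no _     | yes a≡b = ⊥-elim (a≢b a≡b)
  ... | yes refl | yes refl | no _     | no _     rewrite ab = refl
  ... | yes refl | no _     | yes b≡a  | _        = ⊥-elim (a≢b (sym b≡a))
  ... | yes refl | no _     | no _     | _        = ⟦⟧≡⟦∧true⟧+0 (adj G a v)
  ... | no _     | _        | yes refl | yes refl rewrite symm G b a | ab = refl
  ... | no _     | _        | yes refl | no _     = ⟦⟧≡⟦∧true⟧+0 (adj G b v)
  ... | no _     | _        | no _     | _        = ⟦⟧≡⟦∧true⟧+0 (adj G u v)

  form-deleteEdge : ∀ f g → form G f g ≡ form G′ f g + (f a * g b + f b * g a)
  form-deleteEdge f g = begin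
    form G f g
      ≡⟨ sum-cong (λ u → sum-cong λ v → trans (cong (λ x → f u * (x * g v)) (adj-deleteEdge u v))
           (distribute (f u) (adjℕ G′ u v) (δ a u) (δ b v) (δ b u) (δ a v) (g v))) ⟩
    sum (λ u → sum (λ v → f u * (adjℕ G′ u v * g v) + (δ a u * (f u * (δ b v * g v)) + δ b u * (f u * (δ a v * g v)))))
      ≡⟨ sum-cong (λ u → ∑-distrib-+ (λ v → f u * (adjℕ G′ u v * g v)) _) ⟩
    sum (λ u → sum (λ v → f u * (adjℕ G′ u v * g v)) + sum (λ v → δ a u * (f u * (δ b v * g v)) + δ b u * (f u * (δ a v * g v))))
      ≡⟨ ∑-distrib-+ (λ u → sum (λ v → f u * (adjℕ G′ u v * g v))) _ ⟩
    form G′ f g + sum (λ u → sum (λ v → δ a u * (f u * (δ b v * g v)) + δ b u * (f u * (δ a v * g v))))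
      ≡⟨ cong (form G′ f g +_) (trans (sum-cong (λ u → ∑-distrib-+ (λ v → δ a u * (f u * (δ b v * g v))) _))
                                      (∑-distrib-+ (λ u → sum (λ v → δ a u * (f u * (δ b v * g v)))) _)) ⟩
    form G′ f g + (sum (λ u → sum (λ v → δ a u * (f u * (δ b v * g v)))) + sum (λ u → sum (λ v → δ b u * (f u * (δ a v * g v)))))
      ≡⟨ cong (form G′ f g +_) (cong₂ _+_ (sum²-δ a b) (sum²-δ b a)) ⟩
    form G′ f g + (f a * g b + f b * g a) ∎
    where
    open ≡-Reasoning
    distribute : ∀ x y d₁ d₂ d₃ d₄ z → x * ((y + (d₁ * d₂ + d₃ * d₄)) * z)
                 ≡ x * (y * z) + (d₁ * (x * (d₂ * z)) + d₃ * (x * (d₄ * z)))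
    distribute = solve-∀
    sum²-δ : ∀ i j → sum (λ u → sum (λ v → δ i u * (f u * (δ j v * g v)))) ≡ f i * g j
    sum²-δ i j = begin
      sum (λ u → sum (λ v → δ i u * (f u * (δ j v * g v))))
        ≡⟨ sum-cong (λ u → trans (sym (*-distribˡ-sum (δ i u) (λ v → f u * (δ j v * g v))))
             (cong (δ i u *_) (trans (sym (*-distribˡ-sum (f u) (λ v → δ j v * g v))) (cong (f u *_) (sum-δ j g))))) ⟩
      sum (λ u → δ i u * (f u * g j))
        ≡⟨ sum-δ i (λ u → f u * g j) ⟩
      f i * g j ∎

  edges-deleteEdge : edges G ≡ edges G′ + 1
  edges-deleteEdge = *-cancelˡ-≡ (edges G) (edges G′ + 1) 2 (begin
    2 * edges G            ≡⟨ edges-form G ⟩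
    form G 𝟙 𝟙             ≡⟨ form-deleteEdge 𝟙 𝟙 ⟩
    form G′ 𝟙 𝟙 + 2        ≡⟨ cong (_+ 2) (sym (edges-form G′)) ⟩
    2 * edges G′ + 2       ≡⟨ *-distribˡ-+ 2 (edges G′) 1 ⟨
    2 * (edges G′ + 1)     ∎)
    where open ≡-Reasoning

  module _ {P : Fin n → Bool} (Pa : P a ≡ true) (Pb : P b ≡ false) where

    inner-deleteEdge : inner G P ≡ inner G′ P + 0
    inner-deleteEdge = trans (form-deleteEdge (χ P) (χ P))
      (cong (inner G′ P +_) (cong₂ (λ x y → ⟦ x ⟧ * ⟦ y ⟧ + ⟦ y ⟧ * ⟦ x ⟧) Pa Pb))

    inner∁-deleteEdge : inner G (∁ P) ≡ inner G′ (∁ P) + 0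
    inner∁-deleteEdge = trans (form-deleteEdge (χ (∁ P)) (χ (∁ P)))
      (cong (inner G′ (∁ P) +_) (cong₂ (λ x y → ⟦ not x ⟧ * ⟦ not y ⟧ + ⟦ not y ⟧ * ⟦ not x ⟧) Pa Pb))

    cut-deleteEdge : cut G P ≡ cut G′ P + 1
    cut-deleteEdge = trans (form-deleteEdge (χ P) (χ (∁ P)))
      (cong (cut G′ P +_) (cong₂ (λ x y → ⟦ x ⟧ * ⟦ not y ⟧ + ⟦ y ⟧ * ⟦ not x ⟧) Pa Pb))

    0<q-deleteEdge : inner G P * inner G (∁ P) ≡ cut G P * cut G P → QStarPos G′
    0<q-deleteEdge XZ≡C² = twoBlock P a b , 0<q-twoBlock G′ P a≢b (begin-strict
      C′ * C′                        <⟨ n²<[1+n]² C′ ⟩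
      (C′ + 1) * (C′ + 1)            ≡⟨ cong (λ c → c * c) cut-deleteEdge ⟨
      cut G P * cut G P              ≡⟨ XZ≡C² ⟨
      inner G P * inner G (∁ P)      ≡⟨ cong₂ _*_ inner-deleteEdge inner∁-deleteEdge ⟩
      (X′ + 0) * (Z′ + 0)            ≡⟨ cong₂ _*_ (+-identityʳ X′) (+-identityʳ Z′) ⟩
      X′ * Z′                        ∎)
      where
      open ≤-Reasoning
      C′ = cut G′ P
      X′ = inner G′ P
      Z′ = inner G′ (∁ P)
      n²<[1+n]² : ∀ c → c * c < (c + 1) * (c + 1)
      n²<[1+n]² c = subst (c * c <_) (expand c) (s≤s (m≤m+n (c * c) (2 * c)))
        where
        expand : ∀ c → suc (c * c + 2 * c) ≡ (c + 1) * (c + 1)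
        expand = solve-∀

⟦⟧-injective : ∀ {x y} → ⟦ x ⟧ ≡ ⟦ y ⟧ → x ≡ y
⟦⟧-injective {true}  {true}  _ = refl
⟦⟧-injective {false} {false} _ = refl

⊆-edges-≡⇒adj-≡ : ∀ {n} {G H : Graph n} → H ⊆G G → edges G ≡ edges H + 0 → ∀ u v → adj H u v ≡ adj G u v
⊆-edges-≡⇒adj-≡ {n} {G} {H} H⊆G same u v =
  ⟦⟧-injective (sum-≡⇒≗ (adj-mono u) (sum-≡⇒≗ (λ w → sum-mono-≤ (adj-mono w)) sums-≡ u) v)
  where
  adj-mono : ∀ u v → adjℕ H u v ≤ adjℕ G u v
  adj-mono u v with adj H u v in eq
  ... | false = z≤n
  ... | true  rewrite H⊆G u v eq = ≤-refl
  sums-≡ : sum (λ u → sum (adjℕ H u)) ≡ sum (λ u → sum (adjℕ G u))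
  sums-≡ = begin
    sum (λ u → sum (adjℕ H u))  ≡⟨ sum²-upper-pairs (adj H) (symm H) (irrefl H) ⟨
    2 * edges H                 ≡⟨ cong (2 *_) (trans (sym (+-identityʳ (edges H))) (sym same)) ⟩
    2 * edges G                 ≡⟨ sum²-upper-pairs (adj G) (symm G) (irrefl G) ⟩
    sum (λ u → sum (adjℕ G u))  ∎
    where open ≡-Reasoning

prefix : ∀ {n k} → (Fin n → Fin k) → (Fin k → ℕ) → Fin n → Bool
prefix p t v = before (λ w → δ (p w) (p v)) v <ᵇ t (p v)

module _ {n k : ℕ} (p : Fin n → Fin k) where

  partSize≡mass-𝟙 : ∀ i → partSize p i ≡ mass p 𝟙 i
  partSize≡mass-𝟙 i = trans (ΣFin≡sum (λ v → δ (p v) i)) (sum-cong λ v → sym (*-identityʳ (δ (p v) i)))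

  mass-prefix : ∀ t → (∀ i → t i ≤ partSize p i) → ∀ i → mass p (χ (prefix p t)) i ≡ t i
  mass-prefix t t≤size i = begin
    mass p (χ (prefix p t)) i                 ≡⟨ sum-cong pointwise ⟩
    sum (λ v → g v * ⟦ before g v <ᵇ t i ⟧)   ≡⟨ sum-select-prefix g (λ v → δ≤1 (p v) i) (t i) ⟩
    t i ⊓ sum g                               ≡⟨ m≤n⇒m⊓n≡m (subst (t i ≤_) (ΣFin≡sum g) (t≤size i)) ⟩
    t i                                       ∎
    where
    open ≡-Reasoning
    g : Fin n → ℕ
    g w = δ (p w) i
    pointwise : ∀ v → δ (p v) i * χ (prefix p t) v ≡ g v * ⟦ before g v <ᵇ t i ⟧
    pointwise v with p v ≟ i
    ... | yes refl = refl
    ... | no _     = refl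

  mass-∁ : ∀ P i → mass p (χ P) i + mass p (χ (∁ P)) i ≡ partSize p i
  mass-∁ P i = begin
    mass p (χ P) i + mass p (χ (∁ P)) i  ≡⟨ ∑-distrib-+ (λ u → δ (p u) i * χ P u) _ ⟨
    sum (λ u → δ (p u) i * χ P u + δ (p u) i * χ (∁ P) u)
      ≡⟨ sum-cong (λ u → trans (cong (δ (p u) i *_) (𝟙≡χ+χ∁ P u)) (*-distribˡ-+ (δ (p u) i) (χ P u) (χ (∁ P) u))) ⟨
    mass p 𝟙 i                           ≡⟨ partSize≡mass-𝟙 i ⟨
    partSize p i                         ∎
    where open ≡-Reasoning

  mass>0⇒∃ : ∀ P i → 0 < mass p (χ P) i → ∃ λ v → p v ≡ i × P v ≡ true
  mass>0⇒∃ P i 0<mass with sum>0⇒∃>0 (λ v → δ (p v) i * χ P v) 0<mass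
  ... | v , 0<term with p v ≟ i | P v in Pv
  ...   | yes pv≡i | true = v , pv≡i , Pv
  -- in the remaining cases 0<term has type 0 < 0, so they need no clause

module _ {n k : ℕ} {G : Graph n} {p : Fin n → Fin k} (multipartite : Multipartite G p) where

  deleting-no-edge-keeps-q≯0 : ∀ (H : Graph n) j → H ⊆G G → edges G ≡ edges H + j → j < 1 → ¬ QStarPos H
  deleting-no-edge-keeps-q≯0 H zero H⊆G same _ (c , 0<q) = q≯0 multipartite-H c 0<q
    where
    adj-≡ : ∀ u v → adj H u v ≡ adj G u v
    adj-≡ = ⊆-edges-≡⇒adj-≡ {G = G} {H} H⊆G same
    multipartite-H : Multipartite H p
    multipartite-H u v = (λ uv → proj₁ (multipartite u v) (trans (sym (adj-≡ u v)) uv))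
                       , (λ apart → trans (adj-≡ u v) (proj₂ (multipartite u v) apart))
  deleting-no-edge-keeps-q≯0 H (suc j) _ _ (s≤s ())

  module _ (nonempty : ∀ i → ∃ λ v → p v ≡ i)
           (t : Fin k → ℕ) (r : ℕ) (size : ∀ i → partSize p i ≡ t i * suc (suc r)) where

    private
      P = prefix p t

      mass-P : ∀ i → mass p (χ P) i ≡ t i
      mass-P = mass-prefix p t (λ i → subst (t i ≤_) (sym (size i)) (m≤m*n (t i) (suc (suc r))))

      mass-∁P : ∀ i → mass p (χ (∁ P)) i ≡ suc r * mass p (χ P) i
      mass-∁P i = +-cancelˡ-≡ (t i) _ _ (begin
        t i + mass p (χ (∁ P)) i               ≡⟨ cong (_+ mass p (χ (∁ P)) i) (mass-P i) ⟨
        mass p (χ P) i + mass p (χ (∁ P)) i    ≡⟨ mass-∁ p P i ⟩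
        partSize p i                           ≡⟨ size i ⟩
        t i * suc (suc r)                      ≡⟨ *-suc (t i) (suc r) ⟩
        t i + t i * suc r                      ≡⟨ cong (t i +_) (*-comm (t i) (suc r)) ⟩
        t i + suc r * t i                      ≡⟨ cong (λ x → t i + suc r * x) (mass-P i) ⟨
        t i + suc r * mass p (χ P) i           ∎)
        where open ≡-Reasoning

      t>0 : ∀ i → 0 < t i
      t>0 i = *-cancelʳ-< (suc (suc r)) 0 (t i) (subst (0 <_) (size i) part-inhabited)
        where
        v = proj₁ (nonempty i)
        part-inhabited : 0 < partSize p i
        part-inhabited = subst (0 <_) (sym (ΣFin≡sum (λ w → δ (p w) i)))
          (subst (_≤ sum (λ w → δ (p w) i)) (δ-≡ (proj₂ (nonempty i))) (≤-sum (λ w → δ (p w) i) v))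

      mass-P>0 : ∀ i → 0 < mass p (χ P) i
      mass-P>0 i = subst (0 <_) (sym (mass-P i)) (t>0 i)

      mass-∁P>0 : ∀ i → 0 < mass p (χ (∁ P)) i
      mass-∁P>0 i = subst (0 <_) (sym (mass-∁P i))
        (subst (_< suc r * mass p (χ P) i) (*-zeroʳ (suc r)) (*-monoʳ-< (suc r) (mass-P>0 i)))

    deleting-a-cut-edge : ∀ i j → ¬ i ≡ j →
      Σ (Graph n) λ H → H ⊆G G × (edges G ≡ edges H + 1) × QStarPos H
    deleting-a-cut-edge i j i≢j with mass>0⇒∃ p P i (mass-P>0 i) | mass>0⇒∃ p (∁ P) j (mass-∁P>0 j)
    ... | a , pa≡i , Pa | b , pb≡j , ∁Pb =
      deleteEdge G a b , deleteEdge-⊆ G a b , edges-deleteEdge G a≢b ab , 0<q-deleteEdge G a≢b ab Pa Pb XZ≡C²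
      where
      apart : ¬ p a ≡ p b
      apart pa≡pb = i≢j (trans (sym pa≡i) (trans pa≡pb pb≡j))
      a≢b : ¬ a ≡ b
      a≢b = apart ∘ cong p
      ab : adj G a b ≡ true
      ab = proj₂ (multipartite a b) apart
      Pb : P b ≡ false
      Pb = not-injective ∁Pb
      XZ≡C² : inner G P * inner G (∁ P) ≡ cut G P * cut G P
      XZ≡C² = form²≡cross² {H = G} multipartite (χ P) (χ (∁ P)) (suc r) mass-∁P

proposition2p6 : (n k : ℕ) (G : Graph n) (p : Fin n → Fin k) →
    2 ≤ k → IsCompleteMultipartite G p →
    (ℓ : ℕ) → 2 ≤ ℓ → (∀ i → ℓ ∣ partSize p i) →
    δ⁻≡ G 1
proposition2p6 n (suc (suc k)) G p (s≤s (s≤s _)) (nonempty , multipartite) (suc (suc r)) (s≤s (s≤s _)) ℓ∣size =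
    deleting-a-cut-edge {G = G} multipartite nonempty t r size zero (suc zero) (λ ())
  , deleting-no-edge-keeps-q≯0 {G = G} multipartite
  where
  t : Fin (suc (suc k)) → ℕ
  t i = _∣_.quotient (ℓ∣size i)
  size : ∀ i → partSize p i ≡ t i * suc (suc r)
  size i = _∣_.equality (ℓ∣size i)
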